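{- Let $c\in C$. For every positive integer $n$ and every $k\in K(n)$, one has $c\in E(n,k)$ and $\#(k,c,\sigma)=\#(c)$ for every $\sigma\in\Xi(k)$.
   Context: Language $(V,F,C,\#)$: variables $V$; constants $C$ with meanings $\#(c)$; operator symbols $F$, each $f$ with applicability condition $A_f(x_1,\dots,x_n)$ and value $P_f(x_1,\dots,x_n)$ when applicable; auxiliary symbols $($, $)$, $,$, $:$, $\{\}$; all disjoint and uniquely readable; expressions are strings. Soops: finite sequences of ordered pairs; $\varepsilon$ empty, $\|$ concatenation; $\mathrm{dom}$ = set of first components; $\alpha(a)=b$; $\alpha\sqsubseteq\gamma$: initial segment. Simultaneous induction on $n\ge1$ defining contexts $K(n)$, states $\Xi(k)$, expressions $E(n,k)$, meanings $\#(k,t,\sigma)$ and $V_b(t),V_f(t)$: $K(1)=\{\varepsilon\}$, $\Xi(\varepsilon)=\{\varepsilon\}$, $E(1,\varepsilon)=C$, $\#(\varepsilon,c,\varepsilon)=\#(c)$, $V_b(c)=V_f(c)=\emptyset$. $K(n)^+$: all $h\|(y,\varphi)$, $h\in K(n)$, $\varphi\in E(n,h)$, $y\in V\setminus\mathrm{dom}(h)$, $\#(h,\varphi,\rho)$ a set for all $\rho\in\Xi(h)$; $K(n+1)=K(n)\cup K(n)^+$; $\Xi(h\|(y,\varphi))=\{\rho\|(y,s):\rho\in\Xi(h),s\in\#(h,\varphi,\rho)\}$. $E(n+1,k)$ is the union of: (0) $E(n,k)$ if $k\in K(n)$ (meanings unchanged); (a) for $k=h\|(y,\varphi)\in K(n)^+$,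 $t\in E(n,h)$ with $y\notin V_b(t)$, $\#(k,t,\rho\|(y,s))=\#(h,t,\rho)$; (b) for such $k$, $y$ itself, $\#(k,y,\sigma)=\sigma(y)$, $V_f(y)=\{y\}$, $V_b(y)=\emptyset$; (c) for $k\in K(n)$, $(\varphi)(\varphi_1,\dots,\varphi_m)$ with $\varphi,\varphi_i\in E(n,k)$, $\#(k,\varphi,\sigma)$ an $m$-ary function defined at $(\#(k,\varphi_i,\sigma))_i$ for all $\sigma$, meaning its value, $V_b,V_f$ unions; (d) for $k\in K(n)$, $(f)(\varphi_1,\dots,\varphi_m)$, $f\in F$, $\varphi_i\in E(n,k)$, $A_f(\#(k,\varphi_1,\sigma),\dots)$ for all $\sigma$, meaning $P_f(\dots)$, $V_b,V_f$ unions; (e) for $k\in K(n)$, $\{\}(x_1:\varphi_1,\dots,x_m:\varphi_m,\varphi)$, $x_i$ distinct in $V\setminus\mathrm{dom}(k)$, $k'_i=k\|(x_1,\varphi_1)\|\dots\|(x_i,\varphi_i)\in K(n)$, $\varphi_i\in E(n,k'_{i-1})$ with set meanings, $\varphi\in E(n,k'_m)$; meaning $\{\#(k'_m,\varphi,\sigma'):\sigma'\in\Xi(k'_m),\sigma\sqsubseteq\sigma'\}$; $V_b=\{x_1,\dots,x_m\}\cup\bigcup V_b(\varphi_i)\cup V_b(\varphi)$; $V_f=V_f(\varphi_1)\cup(V_f(\varphi_2)\setminus\{x_1\})\cup\dots\cup(V_f(\varphi)\setminus\{x_1,\dots,x_m\})$. -}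

module Defs where

open import Data.Nat using (ℕ; zero; suc; _∸_)
open import Data.Product using (Σ; Σ-syntax; ∃; _×_; _,_; proj₁; proj₂)
open import Data.Sum using (_⊎_)
open import Data.Empty using (⊥)
open import Data.List using (List; []; _∷_; _++_; _∷ʳ_; map; length)
open import Data.List.Membership.Propositional using (_∈_; _∉_)
open import Data.List.Relation.Unary.All using (All)
open import Data.List.Relation.Unary.AllPairs using (AllPairs)
open import Data.List.Relation.Binary.Pointwise using (Pointwise)
open import Relation.Binary.PropositionalEquality using (_≡_; _≢_)
open import Relation.Nullary using (¬_)

-- The data of a language (V, F, C, #) together with an abstract universe of
-- meanings (the "sets" of the ambient set theory).
record Language : Set₁ where
  field
    Var   : Set
    Const : Set
    Op    : Set
    Val   : Set
    _∈ᵛ_  : Val → Val → Set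
    IsSet : Val → Set
    IsFun : ℕ → Val → Set
    App   : Val → List Val → Val → Set  -- f is defined at args with value w
    ⟦_⟧   : Const → Val
    Appl  : Op → List Val → Set
    Pval  : Op → List Val → Val

module Lang (L : Language) where
  open Language L

  -- Expressions as (uniquely readable) abstract syntax.
  data Expr : Set where
    const : Const → Expr
    var   : Var → Expr
    app   : Expr → List Expr → Expr
    op    : Op → List Expr → Expr
    setb  : List (Var × Expr) → Expr → Expr          -- {}(x₁:φ₁,…,xₘ:φₘ,φ)

  Ctx : Set
  Ctx = List (Var × Expr)

  State : Set
  State = List (Var × Val)

  dom : ∀ {A : Set} → List (Var × A) → List Var
  dom = map proj₁

  mutual
    _∈Vb_ : Var → Expr → Set
    x ∈Vb const c = ⊥
    x ∈Vb var y = ⊥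
    x ∈Vb app φ φs = x ∈Vb φ ⊎ x ∈Vbs φs
    x ∈Vb op f φs = x ∈Vbs φs
    x ∈Vb setb bs φ = x ∈ dom bs ⊎ x ∈VbB bs ⊎ x ∈Vb φ

    _∈Vbs_ : Var → List Expr → Set
    x ∈Vbs [] = ⊥
    x ∈Vbs (φ ∷ φs) = x ∈Vb φ ⊎ x ∈Vbs φs

    _∈VbB_ : Var → List (Var × Expr) → Set
    x ∈VbB [] = ⊥
    x ∈VbB ((y , φ) ∷ bs) = x ∈Vb φ ⊎ x ∈VbB bs

  mutual
    _∈Vf_ : Var → Expr → Set
    x ∈Vf const c = ⊥
    x ∈Vf var y = x ≡ y
    x ∈Vf app φ φs = x ∈Vf φ ⊎ x ∈Vfs φs
    x ∈Vf op f φs = x ∈Vfs φs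
    x ∈Vf setb bs φ = VfB x bs [] ⊎ (x ∈Vf φ × x ∉ dom bs)

    _∈Vfs_ : Var → List Expr → Set
    x ∈Vfs [] = ⊥
    x ∈Vfs (φ ∷ φs) = x ∈Vf φ ⊎ x ∈Vfs φs

    -- V_f(φ₁) ∪ (V_f(φ₂) ∖ {x₁}) ∪ … ; `prev` = previously bound x's
    VfB : Var → List (Var × Expr) → List Var → Set
    VfB x [] prev = ⊥
    VfB x ((y , φ) ∷ bs) prev = (x ∈Vf φ × x ∉ prev) ⊎ VfB x bs (prev ∷ʳ y)

  -- One stage n of the simultaneous induction: K(n), Ξ, E(n,·), #(·,·,·).
  -- Meanings are given relationally: Mean k t σ v  means  #(k,t,σ) = v.
  record Stage : Set₁ where
    field
      K    : Ctx → Set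
      Xi   : Ctx → State → Set
      E    : Ctx → Expr → Set
      Mean : Ctx → Expr → State → Val → Set

  module _ (S : Stage) where
    open Stage S

    IsSetMeaning : Ctx → Expr → State → Set
    IsSetMeaning h φ ρ = (Σ[ v ∈ Val ] Mean h φ ρ v) × (∀ v → Mean h φ ρ v → IsSet v)

    KPlus : Ctx → Ctx → Var → Expr → Set
    KPlus k h y φ = k ≡ h ∷ʳ (y , φ) × K h × E h φ × y ∉ dom h
                    × (∀ ρ → Xi h ρ → IsSetMeaning h φ ρ)

    -- side conditions of clause (e); final context is k ++ bs = k'ₘ
    SetbOK : Ctx → List (Var × Expr) → Expr → Set
    SetbOK k [] φ = E k φ
    SetbOK k ((x , ψ) ∷ bs) φ =
      E k ψ × (∀ ρ → Xi k ρ → IsSetMeaning k ψ ρ)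
      × K (k ∷ʳ (x , ψ)) × SetbOK (k ∷ʳ (x , ψ)) bs φ

    NextK : Ctx → Set
    NextK k = K k ⊎ (Σ[ h ∈ Ctx ] Σ[ y ∈ Var ] Σ[ φ ∈ Expr ] KPlus k h y φ)

    NextXi : Ctx → State → Set
    NextXi k σ = (K k × Xi k σ)
      ⊎ (Σ[ h ∈ Ctx ] Σ[ y ∈ Var ] Σ[ φ ∈ Expr ] KPlus k h y φ
          × Σ[ ρ ∈ State ] Σ[ s ∈ Val ] σ ≡ ρ ∷ʳ (y , s) × Xi h ρ
          × Σ[ v ∈ Val ] Mean h φ ρ v × s ∈ᵛ v)

    data NextE : Ctx → Expr → Set where
      e0 : ∀ {k t} → K k → E k t → NextE k t
      ea : ∀ {k h y φ t} → KPlus k h y φ → E h t → ¬ (y ∈Vb t) → NextE k t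
      eb : ∀ {k h y φ} → KPlus k h y φ → NextE k (var y)
      ec : ∀ {k φ φs} → K k → E k φ → All (E k) φs →
           (∀ σ → Xi k σ →
              Σ[ fv ∈ Val ] Mean k φ σ fv × IsFun (length φs) fv
              × Σ[ as ∈ List Val ] Pointwise (λ ψ a → Mean k ψ σ a) φs as
              × Σ[ w ∈ Val ] App fv as w) →
           NextE k (app φ φs)
      ed : ∀ {k f φs} → K k → All (E k) φs →
           (∀ σ → Xi k σ →
              Σ[ as ∈ List Val ] Pointwise (λ ψ a → Mean k ψ σ a) φs as × Appl f as) →
           NextE k (op f φs)
      ee : ∀ {k bs φ} → K k → AllPairs _≢_ (dom bs) → All (λ x → x ∉ dom k) (dom bs) →
           SetbOK k bs φ → NextE k (setb bs φ)

    data NextMean : Ctx → Expr → State → Val → Set where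
      m0 : ∀ {k t σ v} → K k → E k t → Mean k t σ v → NextMean k t σ v
      ma : ∀ {k h y φ t ρ s v} → KPlus k h y φ → E h t → ¬ (y ∈Vb t) →
           Mean h t ρ v → NextMean k t (ρ ∷ʳ (y , s)) v
      mb : ∀ {k h y φ σ v} → KPlus k h y φ → (y , v) ∈ σ → NextMean k (var y) σ v
      mc : ∀ {k φ φs σ v} → K k → (fv : Val) → Mean k φ σ fv → (as : List Val) →
           Pointwise (λ ψ a → Mean k ψ σ a) φs as → App fv as v →
           NextMean k (app φ φs) σ v
      md : ∀ {k f φs σ} → K k → (as : List Val) →
           Pointwise (λ ψ a → Mean k ψ σ a) φs as → Appl f as →
           NextMean k (op f φs) σ (Pval f as)
      me : ∀ {k bs φ σ v} → K k → IsSet v →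
           (∀ w → (w ∈ᵛ v →
                     Σ[ σ' ∈ State ] Xi (k ++ bs) σ' × (Σ[ τ ∈ State ] σ' ≡ σ ++ τ)
                       × Mean (k ++ bs) φ σ' w)
                × ((Σ[ σ' ∈ State ] Xi (k ++ bs) σ' × (Σ[ τ ∈ State ] σ' ≡ σ ++ τ)
                       × Mean (k ++ bs) φ σ' w) → w ∈ᵛ v)) →
           NextMean k (setb bs φ) σ v

  next : Stage → Stage
  next S = record { K = NextK S ; Xi = NextXi S ; E = NextE S ; Mean = NextMean S }

  base : Stage
  base = record
    { K    = λ k → k ≡ []
    ; Xi   = λ k σ → k ≡ [] × σ ≡ []
    ; E    = λ k t → k ≡ [] × Σ[ c ∈ Const ] t ≡ const c
    ; Mean = λ k t σ v → k ≡ [] × σ ≡ [] × Σ[ c ∈ Const ] t ≡ const c × v ≡ ⟦ c ⟧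
    }

  -- stage' m is stage n = m + 1
  stage' : ℕ → Stage
  stage' zero = base
  stage' (suc m) = next (stage' m)

  K : ℕ → Ctx → Set
  K n = Stage.K (stage' (n ∸ 1))

  Ξ : ℕ → Ctx → State → Set
  Ξ n = Stage.Xi (stage' (n ∸ 1))

  E : ℕ → Ctx → Expr → Set
  E n = Stage.E (stage' (n ∸ 1))

  Mean : ℕ → Ctx → Expr → State → Val → Set
  Mean n = Stage.Mean (stage' (n ∸ 1))

module Submission where

-- We phrase the claim as two invariants of a single stage S of the
-- simultaneous induction:
--   * ConstantMeaningful S : in every context k ∈ K, c ∈ E(k) and
--                            #(k,c,σ) = #(c) for every σ ∈ Ξ(k);
--   * ConstantDetermined S : whenever #(k,c,σ) = v, then v = #(c).
-- Both hold at the base stage (only constants are expressions there), and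
-- both are preserved by one step `next`: a constant is never a variable,
-- never bound (V_b(c) = ∅), and its only clauses in E(n+1,·) are (0) and (a),
-- which transport the previous meaning unchanged.

open import Defs
open import Data.Nat using (ℕ; _≤_; zero; suc; s≤s)
open import Data.Product using (_×_; _,_; proj₁; proj₂)
open import Data.Sum using (inj₁; inj₂)
open import Relation.Binary.PropositionalEquality using (_≡_; refl)

module Constants (L : Language) (c : Language.Const L) where
  open Language L
  open Lang L

  ConstantMeaningful : Stage → Set
  ConstantMeaningful S =
    ∀ k → Stage.K S k → Stage.E S k (const c)
    × (∀ σ → Stage.Xi S k σ → Stage.Mean S k (const c) σ ⟦ c ⟧)

  ConstantDetermined : Stage → Set
  ConstantDetermined S = ∀ k σ v → Stage.Mean S k (const c) σ v → v ≡ ⟦ c ⟧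

  base-meaningful : ConstantMeaningful base
  base-meaningful k refl = (refl , c , refl) , λ { σ (refl , refl) → refl , refl , c , refl , refl }

  base-determined : ConstantDetermined base
  base-determined k σ v (_ , _ , _ , refl , v≡⟦c⟧) = v≡⟦c⟧

  -- Step (0) keeps c in old contexts; step (a) carries it into an extension
  -- h ‖ (y,φ), since y ∉ V_b(c) = ∅.  Both keep the meaning #(c).
  next-meaningful : ∀ S → ConstantMeaningful S → ConstantMeaningful (next S)
  next-meaningful S ih k k∈K = expression k∈K , meaning
    where
    expression : NextK S k → NextE S k (const c)
    expression (inj₁ k∈K) = e0 k∈K (proj₁ (ih k k∈K))
    expression (inj₂ (h , y , φ , k⁺)) = ea k⁺ (proj₁ (ih h (proj₁ (proj₂ k⁺)))) (λ ())

    meaning : ∀ σ → NextXi S k σ → NextMean S k (const c) σ ⟦ c ⟧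
    meaning σ (inj₁ (k∈K , σ∈Ξ)) = m0 k∈K (proj₁ (ih k k∈K)) (proj₂ (ih k k∈K) σ σ∈Ξ)
    meaning σ (inj₂ (h , y , φ , k⁺ , ρ , s , refl , ρ∈Ξ , _)) =
      ma k⁺ (proj₁ (ih h h∈K)) (λ ()) (proj₂ (ih h h∈K) ρ ρ∈Ξ)
      where
      h∈K : Stage.K S h
      h∈K = proj₁ (proj₂ k⁺)

  -- Only the transporting clauses (0) and (a) can give c a meaning.
  next-determined : ∀ S → ConstantDetermined S → ConstantDetermined (next S)
  next-determined S ih k σ v (m0 _ _ M) = ih k σ v M
  next-determined S ih k σ v (ma _ _ _ M) = ih _ _ v M

  meaningful : ∀ m → ConstantMeaningful (stage' m)
  meaningful zero = base-meaningful
  meaningful (suc m) = next-meaningful (stage' m) (meaningful m)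

  determined : ∀ m → ConstantDetermined (stage' m)
  determined zero = base-determined
  determined (suc m) = next-determined (stage' m) (determined m)

-- Stage n ≥ 1 is stage' (n - 1); read off both invariants there.
lemma3p12 : (L : Language) (c : Language.Const L) (n : ℕ) → 1 ≤ n →
    (k : Lang.Ctx L) → Lang.K L n k →
    Lang.E L n k (Lang.const c)
    × ((σ : Lang.State L) → Lang.Ξ L n k σ →
        Lang.Mean L n k (Lang.const c) σ (Language.⟦_⟧ L c)
        × ((v : Language.Val L) → Lang.Mean L n k (Lang.const c) σ v → v ≡ Language.⟦_⟧ L c))
lemma3p12 L c (suc m) (s≤s _) k k∈K =
  proj₁ (meaningful m k k∈K) ,
  λ σ σ∈Ξ → proj₂ (meaningful m k k∈K) σ σ∈Ξ , λ v → determined m k σ v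
  where open Constants L c
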